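{- There is a polynomial $\mathbf{Res}$ refutation of $\mathit{SPHP}^1$: for every $m\ge1$ there is a proof $\mathit{SPHP}^1_m\vdash_{\mathbf{Res}}\{(\Box,m^2+m+1)\}$ whose length is bounded by a polynomial in $m$ (note $\mathrm{MaxSAT}(\mathit{SPHP}^1_m)=m^2+m+1$).
   Context: A literal is a Boolean variable $x$ or its negation $\overline x$; a clause is a disjunction of literals ($\Box$ is the empty clause). Weights are elements of $\mathbb{R}_{>0}\cup\{\infty\}$. A MaxSAT formula is a finite collection of weighted clauses $(C,w)$, where $(C,u),(C,v)$ may be merged into $(C,u+v)$ and conversely, and weight-$0$ clauses disappear. Cost of an assignment is the sum of weights of falsified clauses; $\mathrm{MaxSAT}(\mathcal F)$ is the minimum cost. $\mathcal G\subseteq\mathcal H$ means every $(C,w)\in\mathcal G$ has some $(C,w')\in\mathcal H$ with $w\le w'$. A proof is a sequence $\mathcal F_0;\dots;\mathcal F_e$ (length $e$), each obtained from the previous by one rule application replacing antecedents by consequents; $\mathcal F\vdash_{\mathbf{Res}}\mathcal G$ means such a proof with $\mathcal F_0=\mathcal F$ and $\mathcal G\subseteq\mathcal F_e$. $\mathbf{Res}$ has the single rule resolution: from $(x\lor A,v),(\overline x\lor B,w)$ ($A,B$ possibly empty), with $m'=\min\{v,w\}$, derive $(A\lor B,m'),(x\lor A,v-m'),(\overline x\lor B,w-m'),(x\lor A\lor\overline B,m'),(\overline x\lor B\lor\overline A,m')$, where for $D=l_1\lor\dots\lor l_p$ the expression $(E\lor\overline D,u)$ stands for $(E\lor\overline{l_1},u),(E\lor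 l_1\lor\overline{l_2},u),\dots,(E\lor l_1\lor\dots\lor l_{p-1}\lor\overline{l_p},u)$ (nothing if $D$ is empty), tautologies discarded. For $m\ge1$ take variables $x_{ij}$, $1\le i\le m+1$, $1\le j\le m$; let $\mathcal K_m$ consist of the clauses $x_{i1}\lor\dots\lor x_{im}$ for each $i$ and $\overline x_{ij}\lor\overline x_{i'j}$ for each $j$ and $1\le i<i'\le m+1$. $\mathit{SPHP}^1_m=\{(C,1)\mid C\in\mathcal K_m\}\cup\{(x_{ij},1),(\overline x_{ij},1)\mid 1\le i\le m+1,1\le j\le m\}$. -}

module Defs where

open import Data.Nat as ℕ using (ℕ; zero; suc; _≡ᵇ_)
open import Data.Bool using (Bool; true; false; _∧_; _∨_; not; if_then_else_)
open import Data.Product using (_×_; _,_; proj₁; proj₂; Σ; ∃)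
open import Data.List using (List; []; _∷_; _++_; [_]; map; filter; concatMap; upTo)
open import Data.Bool.ListAction using (any; all)
open import Data.Rational using (ℚ; 0ℚ; 1ℚ; _+_; _-_; _⊓_; _≤_)
open import Data.List.Relation.Unary.All using (All)
open import Relation.Binary.PropositionalEquality using (_≡_)
open import Relation.Nullary.Decidable using (T?)
open import Data.Bool using (T)

-- Boolean variables are indexed by pairs of naturals (enough to name x_ij).
Var : Set
Var = ℕ × ℕ

data Lit : Set where
  pos : Var → Lit
  neg : Var → Lit

negate : Lit → Lit
negate (pos x) = neg x
negate (neg x) = pos x

_=ᵛ_ : Var → Var → Bool
(a , b) =ᵛ (c , d) = (a ≡ᵇ c) ∧ (b ≡ᵇ d)

_=ˡ_ : Lit → Lit → Bool
pos x =ˡ pos y = x =ᵛ y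
neg x =ˡ neg y = x =ᵛ y
_ =ˡ _ = false

-- A clause is a disjunction of literals, read as a SET of literals
-- (order and repetition are irrelevant; see clause equality below).
Clause : Set
Clause = List Lit

□ : Clause
□ = []

_∈ᵇ_ : Lit → Clause → Bool
l ∈ᵇ C = any (l =ˡ_) C

_⊆ᵇ_ : Clause → Clause → Bool
C ⊆ᵇ D = all (_∈ᵇ D) C

_≈ᶜ_ : Clause → Clause → Bool
C ≈ᶜ D = (C ⊆ᵇ D) ∧ (D ⊆ᵇ C)

tautology : Clause → Bool
tautology C = any (λ l → negate l ∈ᵇ C) C

Formula : Set
Formula = List (Clause × ℚ)

NonNeg : Formula → Set
NonNeg F = All (λ e → 0ℚ ≤ proj₂ e) F

weight : Formula → Clause → ℚ
weight [] C = 0ℚ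
weight ((D , w) ∷ F) C = if D ≈ᶜ C then w + weight F C else weight F C

-- equality of MaxSAT formulas modulo merging/splitting and dropping
-- weight-0 clauses
_≈_ : Formula → Formula → Set
F ≈ G = ∀ C → weight F C ≡ weight G C

_⊑_ : Formula → Formula → Set
G ⊑ H = All (λ e → weight G (proj₁ e) ≤ weight H (proj₁ e)) G

-- (E ∨ D̄ , u)  for D = l₁ ∨ … ∨ l_p :
--   E ∨ l̄₁ , E ∨ l₁ ∨ l̄₂ , … , E ∨ l₁ ∨ … ∨ l_{p-1} ∨ l̄_p
negTail : Clause → Clause → List Clause
negTail E [] = []
negTail E (l ∷ D) = (E ++ [ negate l ]) ∷ negTail (E ++ [ l ]) D

withWeight : ℚ → List Clause → Formula
withWeight u = map (λ C → (C , u))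

resolvents : Var → Clause → Clause → ℚ → ℚ → Formula
resolvents x A B v w =
  filter (λ e → T? (not (tautology (proj₁ e))))
    ( (A ++ B , m')
    ∷ (pos x ∷ A , v - m')
    ∷ (neg x ∷ B , w - m')
    ∷ (withWeight m' (negTail (pos x ∷ A) B)
       ++ withWeight m' (negTail (neg x ∷ B) A)))
  where
  m' = v ⊓ w

data ResStep (F G : Formula) : Set where
  res : (x : Var) (A B : Clause) (v w : ℚ) (R : Formula) →
        NonNeg R →
        0ℚ Data.Rational.< v → 0ℚ Data.Rational.< w →
        F ≈ ((pos x ∷ A , v) ∷ (neg x ∷ B , w) ∷ R) →
        G ≈ (resolvents x A B v w ++ R) →
        ResStep F G

data ResProof : Formula → Formula → ℕ → Set where
  done : ∀ {F} → ResProof F F 0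
  step : ∀ {F G H e} → ResStep F G → ResProof G H e → ResProof F H (suc e)

_⊢Res[_]_ : Formula → ℕ → Formula → Set
F ⊢Res[ e ] G = ∃ λ Fₑ → ResProof F Fₑ e × G ⊑ Fₑ

fromℕ : ℕ → ℚ
fromℕ zero = 0ℚ
fromℕ (suc n) = 1ℚ + fromℕ n

range : ℕ → List ℕ
range n = map suc (upTo n)

K : ℕ → List Clause
K m =  map (λ i → map (λ j → pos (i , j)) (range m)) (range (suc m))
    ++ concatMap (λ j → concatMap (λ i → concatMap (λ i' →
          if i ℕ.<ᵇ i' then [ neg (i , j) ∷ neg (i' , j) ∷ [] ] else [])
          (range (suc m))) (range (suc m))) (range m)

SPHP¹ : ℕ → Formula
SPHP¹ m =  withWeight 1ℚ (K m)
        ++ concatMap (λ i → concatMap (λ j →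
              (pos (i , j) ∷ [] , 1ℚ) ∷ (neg (i , j) ∷ [] , 1ℚ) ∷ [])
              (range m)) (range (suc m))

-- SPHP¹_m is the disjoint union of m + 1 row blocks and m column blocks. The
-- row block of pigeon i consists of x_i1 ∨ … ∨ x_im and the units x̄_i1, …, x̄_im,
-- and m resolutions refute it. The column block of hole j consists of the units
-- x_1j, …, x_{m+1,j} and the exclusions x̄_ij ∨ x̄_tj (i < t). Resolving
-- x_1j ∨ … ∨ x_{t-1,j} with x̄_1j ∨ x̄_tj gives x_2j ∨ … ∨ x_{t-1,j} ∨ x̄_tj and, as a
-- compensation clause of MaxSAT resolution, x_1j ∨ … ∨ x_tj. The former is refuted
-- by the remaining exclusions into row t and the unit x_tj; the latter starts the
-- next stage. So every column yields m empty clauses in O(m²) steps, and altogether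
-- m² + m + 1 empty clauses are derived in O(m³) steps. Derivations are made inside
-- an arbitrary context of nonnegative weight and may leave nonnegative waste, which
-- lets them be composed side by side.

module Submission where

open import Algebra.Bundles using (CommutativeMonoid)
open import Data.Bool using (Bool; true; false; T; not; if_then_else_; _∧_; _∨_)
open import Data.Bool.ListAction using (any; all; and)
open import Data.Bool.Properties using (T-∧)
open import Data.Fin using (toℕ)
open import Data.Fin.Properties using (toℕ<n)
open import Data.List using (List; _∷_; []; _++_; [_]; map; filter; concatMap; length; replicate; applyUpTo; upTo)
import Data.List.Properties as Listₚ
open import Data.List.Relation.Unary.All using (All; []; _∷_)
import Data.List.Relation.Unary.All as All
open import Data.List.Relation.Unary.All.Properties using (All¬⇒¬Any)
import Data.List.Relation.Unary.All.Properties as Allₚ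
open import Data.List.Relation.Unary.Any.Properties using (any⁻)
open import Data.Nat as ℕ using (ℕ; zero; suc; _+_; _*_; _^_; _≤_; _<_; _<ᵇ_)
import Data.Nat.Properties as ℕₚ
open import Data.Nat.Tactic.RingSolver using (solve-∀)
open import Data.Product using (∃; ∃₂; _×_; _,_; proj₁)
open import Data.Rational as ℚ using (ℚ; 0ℚ; 1ℚ)
import Data.Rational.Properties as ℚₚ
open import Algebra.Properties.CommutativeMonoid.Sum ℚₚ.+-0-commutativeMonoid
  using (sum; sum-cong-≗; ∑-distrib-+; ∑-comm; sum-replicate-zero)
open import Data.Rational.Solver using (module +-*-Solver)
open import Function using (_∘_)
open import Function.Bundles using (Equivalence)
open import Level using (0ℓ)
open import Relation.Binary.PropositionalEquality hiding ([_])
open import Relation.Nullary using (¬_; Dec)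
open import Relation.Nullary.Decidable using (T?; from-yes)

open import Defs

weight-++ : ∀ F G C → weight (F ++ G) C ≡ weight F C ℚ.+ weight G C
weight-++ []            G C = sym (ℚₚ.+-identityˡ _)
weight-++ ((D , w) ∷ F) G C with D ≈ᶜ C
... | true  = trans (cong (w ℚ.+_) (weight-++ F G C)) (sym (ℚₚ.+-assoc w _ _))
... | false = weight-++ F G C

NonNeg-++ : ∀ {F G} → NonNeg F → NonNeg G → NonNeg (F ++ G)
NonNeg-++ = Allₚ.++⁺

NonNeg-concatMap : ∀ {A : Set} (f : A → Formula) xs → (∀ x → NonNeg (f x)) → NonNeg (concatMap f xs)
NonNeg-concatMap f []       f≥0 = []
NonNeg-concatMap f (x ∷ xs) f≥0 = NonNeg-++ (f≥0 x) (NonNeg-concatMap f xs f≥0)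

0≤1 : 0ℚ ℚ.≤ 1ℚ
0≤1 = from-yes (0ℚ ℚ.≤? 1ℚ)

0<1 : 0ℚ ℚ.< 1ℚ
0<1 = from-yes (0ℚ ℚ.<? 1ℚ)

withWeight-NonNeg : ∀ {u} → 0ℚ ℚ.≤ u → ∀ Cs → NonNeg (withWeight u Cs)
withWeight-NonNeg u≥0 []       = []
withWeight-NonNeg u≥0 (C ∷ Cs) = u≥0 ∷ withWeight-NonNeg u≥0 Cs

-- Defs._≈_ as a record, so that both formulas can be inferred from a proof.
infix 4 _≋_
record _≋_ (F G : Formula) : Set where
  constructor mk≋
  field weight-≡ : F ≈ G
open _≋_ public

≋-refl : ∀ {F} → F ≋ F
≋-refl = mk≋ λ _ → refl

≋-sym : ∀ {F G} → F ≋ G → G ≋ F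
≋-sym (mk≋ p) = mk≋ λ C → sym (p C)

≋-trans : ∀ {F G H} → F ≋ G → G ≋ H → F ≋ H
≋-trans (mk≋ p) (mk≋ q) = mk≋ λ C → trans (p C) (q C)

≋-reflexive : ∀ {F G} → F ≡ G → F ≋ G
≋-reflexive refl = ≋-refl

++-cong-≋ : ∀ {F F′ G G′} → F ≋ F′ → G ≋ G′ → F ++ G ≋ F′ ++ G′
++-cong-≋ {F} {F′} {G} {G′} (mk≋ p) (mk≋ q) = mk≋ λ C → begin
  weight (F ++ G) C             ≡⟨ weight-++ F G C ⟩
  weight F C ℚ.+ weight G C     ≡⟨ cong₂ ℚ._+_ (p C) (q C) ⟩
  weight F′ C ℚ.+ weight G′ C   ≡⟨ weight-++ F′ G′ C ⟨
  weight (F′ ++ G′) C           ∎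
  where open ≡-Reasoning

++-comm-≋ : ∀ F G → F ++ G ≋ G ++ F
++-comm-≋ F G = mk≋ λ C → begin
  weight (F ++ G) C             ≡⟨ weight-++ F G C ⟩
  weight F C ℚ.+ weight G C     ≡⟨ ℚₚ.+-comm (weight F C) (weight G C) ⟩
  weight G C ℚ.+ weight F C     ≡⟨ weight-++ G F C ⟨
  weight (G ++ F) C             ∎
  where open ≡-Reasoning

formulaCommutativeMonoid : CommutativeMonoid 0ℓ 0ℓ
formulaCommutativeMonoid = record
  { Carrier = Formula
  ; _≈_ = _≋_
  ; _∙_ = _++_
  ; ε = []
  ; isCommutativeMonoid = record
    { isMonoid = record
      { isSemigroup = record
        { isMagma = record
          { isEquivalence = record { refl = ≋-refl ; sym = ≋-sym ; trans = ≋-trans }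
          ; ∙-cong = ++-cong-≋
          }
        ; assoc = λ F G H → ≋-reflexive (Listₚ.++-assoc F G H)
        }
      ; identity = (λ _ → ≋-refl) , (λ F → ≋-reflexive (Listₚ.++-identityʳ F))
      }
    ; comm = ++-comm-≋
    }
  }

open import Algebra.Solver.CommutativeMonoid formulaCommutativeMonoid
  using (solve; _⊜_; _⊕_)

≋-gather : ∀ E U E′ R → E ++ U ++ E′ ++ R ≋ (E ++ E′) ++ U ++ R
≋-gather = solve 4 (λ E U E′ R → E ⊕ (U ⊕ (E′ ⊕ R)) ⊜ (E ⊕ E′) ⊕ (U ⊕ R)) ≋-refl

-- Derivations inside a context of nonnegative weight

infix 4 _⟶[_]_
_⟶[_]_ : Formula → ℕ → Formula → Set
F ⟶[ e ] G = ∃ λ H → ResProof F H e × H ≋ G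

⟶-respˡ : ∀ {F F′ G e} → F ≋ F′ → F′ ⟶[ e ] G → F ⟶[ e ] G
⟶-respˡ F≋F′ (_ , done , H≋G) = _ , done , ≋-trans F≋F′ H≋G
⟶-respˡ F≋F′ (_ , step (res x A B v w R R≥0 v>0 w>0 F′≈ G≈) π , H≋G) =
  _ , step (res x A B v w R R≥0 v>0 w>0 (λ C → trans (weight-≡ F≋F′ C) (F′≈ C)) G≈) π , H≋G

⟶-respʳ : ∀ {F G G′ e} → G ≋ G′ → F ⟶[ e ] G → F ⟶[ e ] G′
⟶-respʳ G≋G′ (H , π , H≋G) = H , π , ≋-trans H≋G G≋G′

_++ᴿ_ : ∀ {F G H e e′} → ResProof F G e → ResProof G H e′ → ResProof F H (e + e′)
done     ++ᴿ π′ = π′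
step s π ++ᴿ π′ = step s (π ++ᴿ π′)

⟶-trans : ∀ {F G H e e′} → F ⟶[ e ] G → G ⟶[ e′ ] H → F ⟶[ e + e′ ] H
⟶-trans (_ , π , G′≋G) G⟶H with ⟶-respˡ G′≋G G⟶H
... | H′ , π′ , H′≋H = H′ , π ++ᴿ π′ , H′≋H

-- The waste W is harmless: ⊑ only bounds weights from below.
infix 4 _⇛[_]_
record _⇛[_]_ (F : Formula) (e : ℕ) (G : Formula) : Set where
  constructor mk⇛
  field run : ∀ S → NonNeg S → ∃ λ W → NonNeg W × F ++ S ⟶[ e ] G ++ W ++ S
open _⇛[_]_ public

⇛-refl : ∀ {F} → F ⇛[ 0 ] F
⇛-refl = mk⇛ λ S _ → [] , [] , _ , done , ≋-refl

⇛-trans : ∀ {F G H e e′} → F ⇛[ e ] G → G ⇛[ e′ ] H → F ⇛[ e + e′ ] H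
⇛-trans {H = H} F⇛G G⇛H = mk⇛ λ S S≥0 →
  let W , W≥0 , F⟶G = run F⇛G S S≥0
      W′ , W′≥0 , G⟶H = run G⇛H (W ++ S) (NonNeg-++ W≥0 S≥0)
  in W′ ++ W , NonNeg-++ W′≥0 W≥0 ,
     ⟶-respʳ (reassoc H W′ W S) (⟶-trans F⟶G G⟶H)
  where
  reassoc : ∀ H W′ W S → H ++ W′ ++ W ++ S ≋ H ++ (W′ ++ W) ++ S
  reassoc = solve 4 (λ H W′ W S → H ⊕ (W′ ⊕ (W ⊕ S)) ⊜ H ⊕ ((W′ ⊕ W) ⊕ S)) ≋-refl

⇛-cost : ∀ {F G e e′} → e ≡ e′ → F ⇛[ e ] G → F ⇛[ e′ ] G
⇛-cost refl F⇛G = F⇛G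

⇛-respˡ : ∀ {F F′ G e} → F ≋ F′ → F′ ⇛[ e ] G → F ⇛[ e ] G
⇛-respˡ F≋F′ F′⇛G = mk⇛ λ S S≥0 →
  let W , W≥0 , F′⟶G = run F′⇛G S S≥0
  in W , W≥0 , ⟶-respˡ (++-cong-≋ F≋F′ ≋-refl) F′⟶G

⇛-respʳ : ∀ {F G G′ e} → G ≋ G′ → F ⇛[ e ] G → F ⇛[ e ] G′
⇛-respʳ G≋G′ F⇛G = mk⇛ λ S S≥0 →
  let W , W≥0 , F⟶G = run F⇛G S S≥0
  in W , W≥0 , ⟶-respʳ (++-cong-≋ G≋G′ ≋-refl) F⟶G

⇛-discard : ∀ {F G W e} → NonNeg W → F ⇛[ e ] G ++ W → F ⇛[ e ] G
⇛-discard {G = G} {W} W≥0 F⇛GW = mk⇛ λ S S≥0 →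
  let W′ , W′≥0 , F⟶GW = run F⇛GW S S≥0
  in W ++ W′ , NonNeg-++ W≥0 W′≥0 , ⟶-respʳ (reassoc G W W′ S) F⟶GW
  where
  reassoc : ∀ G W W′ S → (G ++ W) ++ W′ ++ S ≋ G ++ (W ++ W′) ++ S
  reassoc = solve 4 (λ G W W′ S → (G ⊕ W) ⊕ (W′ ⊕ S) ⊜ G ⊕ ((W ⊕ W′) ⊕ S)) ≋-refl

⇛-frame : ∀ {F G T e} → NonNeg T → F ⇛[ e ] G → F ++ T ⇛[ e ] G ++ T
⇛-frame {F} {G} {T} T≥0 F⇛G = mk⇛ λ S S≥0 →
  let W , W≥0 , F⟶G = run F⇛G (T ++ S) (NonNeg-++ T≥0 S≥0)
  in W , W≥0 , ⟶-respˡ (reassocˡ F T S) (⟶-respʳ (reassocʳ G W T S) F⟶G)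
  where
  reassocˡ : ∀ F T S → (F ++ T) ++ S ≋ F ++ T ++ S
  reassocˡ = solve 3 (λ F T S → (F ⊕ T) ⊕ S ⊜ F ⊕ (T ⊕ S)) ≋-refl
  reassocʳ : ∀ G W T S → G ++ W ++ T ++ S ≋ (G ++ T) ++ W ++ S
  reassocʳ = solve 4 (λ G W T S → G ⊕ (W ⊕ (T ⊕ S)) ⊜ (G ⊕ T) ⊕ (W ⊕ S)) ≋-refl

⇛-++ : ∀ {F F′ G G′ e e′} → NonNeg F′ → NonNeg G →
       F ⇛[ e ] G → F′ ⇛[ e′ ] G′ → F ++ F′ ⇛[ e + e′ ] G ++ G′
⇛-++ {F′ = F′} {G} {G′} F′≥0 G≥0 F⇛G F′⇛G′ =
  ⇛-trans (⇛-frame F′≥0 F⇛G)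
    (⇛-respˡ (++-comm-≋ G F′) (⇛-respʳ (++-comm-≋ G′ G) (⇛-frame G≥0 F′⇛G′)))

□s : ℕ → Formula
□s n = replicate n (□ , 1ℚ)

□s-NonNeg : ∀ n → NonNeg (□s n)
□s-NonNeg zero    = []
□s-NonNeg (suc n) = 0≤1 ∷ □s-NonNeg n

□s-++ : ∀ a b → □s a ++ □s b ≡ □s (a + b)
□s-++ zero    b = refl
□s-++ (suc a) b = cong ((□ , 1ℚ) ∷_) (□s-++ a b)

weight-□s : ∀ n → weight (□s n) □ ≡ fromℕ n
weight-□s zero    = refl
weight-□s (suc n) = cong (1ℚ ℚ.+_) (weight-□s n)

⇛-concatMap-□s : ∀ {A : Set} {f : A → Formula} {e k} (xs : List A) →
  (∀ x → NonNeg (f x)) → (∀ x → f x ⇛[ e ] □s k) → concatMap f xs ⇛[ length xs * e ] □s (length xs * k)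
⇛-concatMap-□s         []       f≥0 f⇛□s = ⇛-refl
⇛-concatMap-□s {f = f} {k = k} (x ∷ xs) f≥0 f⇛□s =
  ⇛-respʳ (≋-reflexive (□s-++ k (length xs * k)))
    (⇛-++ (NonNeg-concatMap f xs f≥0) (□s-NonNeg k) (f⇛□s x) (⇛-concatMap-□s xs f≥0 f⇛□s))

length-range : ∀ n → length (range n) ≡ n
length-range n = trans (Listₚ.length-map suc (upTo n)) (Listₚ.length-upTo n)

⇛-concatMap-range-□s : ∀ n {f : ℕ → Formula} {e k} →
  (∀ i → NonNeg (f i)) → (∀ i → f i ⇛[ e ] □s k) → concatMap f (range n) ⇛[ n * e ] □s (n * k)
⇛-concatMap-range-□s n {f} {e} {k} f≥0 f⇛□s =
  subst (λ l → concatMap f (range n) ⇛[ l * e ] □s (l * k)) (length-range n)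
        (⇛-concatMap-□s (range n) f≥0 f⇛□s)

weight-NonNeg : ∀ F C → NonNeg F → 0ℚ ℚ.≤ weight F C
weight-NonNeg []            C []           = ℚₚ.≤-refl
weight-NonNeg ((D , w) ∷ F) C (w≥0 ∷ F≥0) with D ≈ᶜ C
... | true  = ℚₚ.+-mono-≤ w≥0 (weight-NonNeg F C F≥0)
... | false = weight-NonNeg F C F≥0

⇛⇒⊢Res : ∀ {F G e v} → F ⇛[ e ] G → v ℚ.≤ weight G □ → F ⊢Res[ e ] ((□ , v) ∷ [])
⇛⇒⊢Res {F} {G} {v = v} F⇛G v≤G with run F⇛G [] []
... | W , W≥0 , F⟶G with ⟶-respˡ (≋-reflexive (sym (Listₚ.++-identityʳ F))) F⟶G
... | H , π , H≋G = H , π , (v+0≤H ∷ [])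
  where
  v+0≤H : v ℚ.+ 0ℚ ℚ.≤ weight H □
  v+0≤H = subst (v ℚ.+ 0ℚ ℚ.≤_) (sym (trans (weight-≡ H≋G □) (weight-++ G (W ++ []) □)))
                (ℚₚ.+-mono-≤ v≤G (weight-NonNeg (W ++ []) □ (NonNeg-++ W≥0 [])))

NonTautological : Clause → Set
NonTautological C = T (not (tautology C))

nonTautological? : (e : Clause × ℚ) → Dec (NonTautological (proj₁ e))
nonTautological? e = T? (not (tautology (proj₁ e)))

resolve-units : ∀ x A B →
  (pos x ∷ A , 1ℚ) ∷ (neg x ∷ B , 1ℚ) ∷ [] ⇛[ 1 ] resolvents x A B 1ℚ 1ℚ
resolve-units x A B = mk⇛ λ S S≥0 →
  [] , [] , _ , step (res x A B 1ℚ 1ℚ S S≥0 0<1 0<1 (λ _ → refl) (λ _ → refl)) done , ≋-refl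

-- resolvents x A B 1ℚ 1ℚ reduces to filter nonTautological? ((A ++ B , 1ℚ) ∷ sideConsequents x A B).
sideConsequents : Var → Clause → Clause → Formula
sideConsequents x A B =
  (pos x ∷ A , 0ℚ) ∷ (neg x ∷ B , 0ℚ) ∷
  (withWeight 1ℚ (negTail (pos x ∷ A) B) ++ withWeight 1ℚ (negTail (neg x ∷ B) A))

sideConsequents-NonNeg : ∀ x A B → NonNeg (sideConsequents x A B)
sideConsequents-NonNeg x A B = ℚₚ.≤-refl ∷ ℚₚ.≤-refl ∷
  NonNeg-++ (withWeight-NonNeg 0≤1 (negTail (pos x ∷ A) B)) (withWeight-NonNeg 0≤1 (negTail (neg x ∷ B) A))

resolve : ∀ x A B → NonTautological (A ++ B) →
  (pos x ∷ A , 1ℚ) ∷ (neg x ∷ B , 1ℚ) ∷ [] ⇛[ 1 ] (A ++ B , 1ℚ) ∷ []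
resolve x A B A∨B =
  ⇛-discard (Allₚ.filter⁺ nonTautological? (sideConsequents-NonNeg x A B))
    (⇛-respʳ (≋-reflexive (Listₚ.filter-accept nonTautological? A∨B)) (resolve-units x A B))

resolve-retaining : ∀ x A b → NonTautological (A ++ [ b ]) → NonTautological (pos x ∷ A ++ [ negate b ]) →
  (pos x ∷ A , 1ℚ) ∷ (neg x ∷ [ b ] , 1ℚ) ∷ []
    ⇛[ 1 ] (A ++ [ b ] , 1ℚ) ∷ (pos x ∷ A ++ [ negate b ] , 1ℚ) ∷ []
resolve-retaining x A b A∨b x∨A∨¬b =
  ⇛-discard (NonNeg-++ (Allₚ.filter⁺ nonTautological? {xs = spent} (ℚₚ.≤-refl ∷ ℚₚ.≤-refl ∷ []))
                       (Allₚ.filter⁺ nonTautological? (withWeight-NonNeg 0≤1 others)))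
    (⇛-respʳ (≋-trans (≋-reflexive accepted) (regroup [ resolvent ] [ retained ] W₁ W₂))
             (resolve-units x A [ b ]))
  where
  resolvent retained : Clause × ℚ
  resolvent = (A ++ [ b ] , 1ℚ)
  retained = (pos x ∷ A ++ [ negate b ] , 1ℚ)
  spent = (pos x ∷ A , 0ℚ) ∷ (neg x ∷ [ b ] , 0ℚ) ∷ []
  others = negTail (neg x ∷ [ b ]) A
  W₁ = filter nonTautological? spent
  W₂ = filter nonTautological? (withWeight 1ℚ others)
  accepted : resolvents x A [ b ] 1ℚ 1ℚ ≡ resolvent ∷ W₁ ++ retained ∷ W₂
  accepted = begin
    resolvents x A [ b ] 1ℚ 1ℚ
      ≡⟨ Listₚ.filter-accept nonTautological? A∨b ⟩
    resolvent ∷ filter nonTautological? (spent ++ retained ∷ withWeight 1ℚ others)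
      ≡⟨ cong (resolvent ∷_) (Listₚ.filter-++ nonTautological? spent (retained ∷ withWeight 1ℚ others)) ⟩
    resolvent ∷ W₁ ++ filter nonTautological? (retained ∷ withWeight 1ℚ others)
      ≡⟨ cong (λ W → resolvent ∷ W₁ ++ W) (Listₚ.filter-accept nonTautological? x∨A∨¬b) ⟩
    resolvent ∷ W₁ ++ retained ∷ W₂ ∎
    where open ≡-Reasoning
  regroup : ∀ E E′ W W′ → E ++ W ++ E′ ++ W′ ≋ (E ++ E′) ++ W ++ W′
  regroup = solve 4 (λ E E′ W W′ → E ⊕ (W ⊕ (E′ ⊕ W′)) ⊜ (E ⊕ E′) ⊕ (W ⊕ W′)) ≋-refl

¬T⇒T-not : ∀ {b} → ¬ T b → T (not b)
¬T⇒T-not {false} _  = _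
¬T⇒T-not {true}  ¬t = ¬t _

SplitAt : ℕ → Lit → Set
SplitAt t (pos (i , _)) = i < t
SplitAt t (neg (i , _)) = t ≤ i

split-¬complementary : ∀ {t l l′} → SplitAt t l → SplitAt t l′ → ¬ T (negate l =ˡ l′)
split-¬complementary {l = pos (i , _)} {neg (i′ , _)} i<t t≤i′ same =
  ℕₚ.<⇒≢ (ℕₚ.<-≤-trans i<t t≤i′) (ℕₚ.≡ᵇ⇒≡ i i′ (proj₁ (Equivalence.to T-∧ same)))
split-¬complementary {l = neg (i , _)} {pos (i′ , _)} t≤i i′<t same =
  ℕₚ.<⇒≢ (ℕₚ.<-≤-trans i′<t t≤i) (sym (ℕₚ.≡ᵇ⇒≡ i i′ (proj₁ (Equivalence.to T-∧ same))))

split⇒nonTautological : ∀ t {C} → All (SplitAt t) C → NonTautological C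
split⇒nonTautological t {C} split = ¬T⇒T-not (All¬⇒¬Any noComplement ∘ any⁻ _ C)
  where
  noComplement : All (λ l → ¬ T (negate l ∈ᵇ C)) C
  noComplement = All.map (λ l-split → All¬⇒¬Any (All.map (split-¬complementary l-split) split) ∘ any⁻ _ C) split

any-++-dup : ∀ (p : Lit → Bool) L l → any p (L ++ l ∷ l ∷ []) ≡ any p (L ++ [ l ])
any-++-dup p []      l with p l
... | true  = refl
... | false = refl
any-++-dup p (l′ ∷ L) l = cong (p l′ ∨_) (any-++-dup p L l)

all-++-dup : ∀ (p : Lit → Bool) L l → all p (L ++ l ∷ l ∷ []) ≡ all p (L ++ [ l ])
all-++-dup p []      l with p l
... | true  = refl
... | false = refl
all-++-dup p (l′ ∷ L) l = cong (p l′ ∧_) (all-++-dup p L l)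

≈ᶜ-++-dup : ∀ L l E → (L ++ l ∷ l ∷ []) ≈ᶜ E ≡ (L ++ [ l ]) ≈ᶜ E
≈ᶜ-++-dup L l E =
  cong₂ _∧_ (all-++-dup (_∈ᵇ E) L l) (cong and (Listₚ.map-cong (λ l′ → any-++-dup (l′ =ˡ_) L l) E))

≋-sameClause : ∀ {C D} w F → (∀ E → C ≈ᶜ E ≡ D ≈ᶜ E) → (C , w) ∷ F ≋ (D , w) ∷ F
≋-sameClause w F C≈D = mk≋ λ E → cong (λ b → if b then w ℚ.+ weight F E else weight F E) (C≈D E)

-- Refuting the blocks

row : ℕ → List ℕ → Clause
row i js = map (λ j → pos (i , j)) js

rowNegations : ℕ → List ℕ → Formula
rowNegations i js = withWeight 1ℚ (map (λ j → neg (i , j) ∷ []) js)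

row-split : ∀ i js → All (SplitAt (suc i)) (row i js)
row-split i []       = []
row-split i (j ∷ js) = ℕₚ.n<1+n i ∷ row-split i js

row-refutation : ∀ i js → (row i js , 1ℚ) ∷ rowNegations i js ⇛[ length js ] □s 1
row-refutation i []       = ⇛-refl
row-refutation i (j ∷ js) =
  ⇛-trans (⇛-frame (withWeight-NonNeg 0≤1 _)
                   (resolve (i , j) (row i js) [] (split⇒nonTautological (suc i) (Allₚ.++⁺ (row-split i js) []))))
          (⇛-respˡ (≋-reflexive (cong (λ C → (C , 1ℚ) ∷ rowNegations i js) (Listₚ.++-identityʳ (row i js))))
                   (row-refutation i js))

column : ℕ → ℕ → ℕ → Clause
column j a zero    = []
column j a (suc n) = pos (a , j) ∷ column j (suc a) n

exclusions : ℕ → ℕ → ℕ → ℕ → List Clause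
exclusions j a zero    t = []
exclusions j a (suc n) t = (neg (a , j) ∷ neg (t , j) ∷ []) ∷ exclusions j (suc a) n t

column-∷ʳ : ∀ j a n → column j a (suc n) ≡ column j a n ++ [ pos (a + n , j) ]
column-∷ʳ j a zero    = cong (λ i → [ pos (i , j) ]) (sym (ℕₚ.+-identityʳ a))
column-∷ʳ j a (suc n) = cong (pos (a , j) ∷_) (begin
  column j (suc a) (suc n)                      ≡⟨ column-∷ʳ j (suc a) n ⟩
  column j (suc a) n ++ [ pos (suc a + n , j) ] ≡⟨ cong (λ i → column j (suc a) n ++ [ pos (i , j) ]) (ℕₚ.+-suc a n) ⟨
  column j (suc a) n ++ [ pos (a + suc n , j) ] ∎)
  where open ≡-Reasoning

column-split : ∀ j a n {t} → a + n ≤ t → All (SplitAt t) (column j a n)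
column-split j a zero    a≤t   = []
column-split j a (suc n) {t} a+n<t =
  ℕₚ.<-≤-trans (ℕₚ.m<m+n a (ℕ.s≤s ℕ.z≤n)) a+n<t ∷
  column-split j (suc a) n (subst (_≤ t) (ℕₚ.+-suc a n) a+n<t)

-- Each exclusion x̄_aj ∨ x̄_tj removes x_aj; the new copy of x̄_tj is absorbed, clauses being sets.
chain-refutation : ∀ j a n t → a + n ≤ t →
  (column j a n ++ [ neg (t , j) ] , 1ℚ) ∷ (pos (t , j) ∷ [] , 1ℚ) ∷ withWeight 1ℚ (exclusions j a n t)
    ⇛[ suc n ] □s 1
chain-refutation j a zero    t _ =
  ⇛-respˡ (++-comm-≋ [ _ ] [ _ ]) (resolve (t , j) [] [] (split⇒nonTautological 0 []))
chain-refutation j a (suc n) t a+n<t =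
  ⇛-respˡ (≋-gather [ _ ] [ _ ] [ _ ] rest)
    (⇛-trans (⇛-frame (0≤1 ∷ withWeight-NonNeg 0≤1 _) (resolve (a , j) L¬t [ ¬t ] resolvent-nonTaut))
      (⇛-respˡ (≋-trans (≋-reflexive (cong (λ C → (C , 1ℚ) ∷ rest′) (Listₚ.++-assoc L [ ¬t ] [ ¬t ])))
                        (≋-sameClause 1ℚ rest′ (≈ᶜ-++-dup L ¬t)))
        (chain-refutation j (suc a) n t sa+n≤t)))
  where
  ¬t = neg (t , j)
  L = column j (suc a) n
  L¬t = L ++ [ ¬t ]
  rest = withWeight 1ℚ (exclusions j (suc a) n t)
  rest′ = (pos (t , j) ∷ [] , 1ℚ) ∷ rest
  sa+n≤t : suc a + n ≤ t
  sa+n≤t = subst (_≤ t) (ℕₚ.+-suc a n) a+n<t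
  resolvent-nonTaut : NonTautological (L¬t ++ [ ¬t ])
  resolvent-nonTaut = split⇒nonTautological t
    (Allₚ.++⁺ (Allₚ.++⁺ (column-split j (suc a) n sa+n≤t) (ℕₚ.≤-refl ∷ [])) (ℕₚ.≤-refl ∷ []))

column-stage : ∀ j a n → let t = a + suc n in
  (column j a (suc n) , 1ℚ) ∷ (pos (t , j) ∷ [] , 1ℚ) ∷ withWeight 1ℚ (exclusions j a (suc n) t)
    ⇛[ suc (suc n) ] (□ , 1ℚ) ∷ (column j a (suc (suc n)) , 1ℚ) ∷ []
column-stage j a n =
  ⇛-respˡ (≋-gather [ _ ] [ _ ] [ _ ] rest)
    (⇛-trans (⇛-frame (0≤1 ∷ withWeight-NonNeg 0≤1 _)
                      (resolve-retaining (a , j) L ¬t resolvent-nonTaut retained-nonTaut))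
      (⇛-respˡ (set-aside [ _ ] [ _ ] (_ ∷ rest))
        (⇛-respʳ (≋-reflexive (cong (λ C → (□ , 1ℚ) ∷ (C , 1ℚ) ∷ []) (sym (column-∷ʳ j a (suc n)))))
          (⇛-frame (0≤1 ∷ []) (chain-refutation j (suc a) n t (ℕₚ.≤-reflexive sa+n≡t))))))
  where
  t = a + suc n
  ¬t = neg (t , j)
  L = column j (suc a) n
  rest = withWeight 1ℚ (exclusions j (suc a) n t)
  sa+n≡t : suc a + n ≡ t
  sa+n≡t = sym (ℕₚ.+-suc a n)
  resolvent-nonTaut : NonTautological (L ++ [ ¬t ])
  resolvent-nonTaut = split⇒nonTautological t
    (Allₚ.++⁺ (column-split j (suc a) n (ℕₚ.≤-reflexive sa+n≡t)) (ℕₚ.≤-refl ∷ []))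
  retained-nonTaut : NonTautological (pos (a , j) ∷ L ++ [ pos (t , j) ])
  retained-nonTaut = split⇒nonTautological (suc t)
    (Allₚ.++⁺ (column-split j a (suc n) (ℕₚ.n≤1+n t)) (ℕₚ.n<1+n t ∷ []))
  set-aside : ∀ E E′ R → E ++ E′ ++ R ≋ (E ++ R) ++ E′
  set-aside = solve 3 (λ E E′ R → E ⊕ (E′ ⊕ R) ⊜ (E ⊕ R) ⊕ E′) ≋-refl

columnTail : ℕ → ℕ → ℕ → ℕ → List Clause
columnTail j a k zero    = []
columnTail j a k (suc n) = (pos (a + k , j) ∷ []) ∷ exclusions j a k (a + k) ++ columnTail j a (suc k) n

columnCost : ℕ → ℕ → ℕ
columnCost k zero    = 0
columnCost k (suc n) = suc (suc k) + columnCost (suc k) n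

column-refutation : ∀ j a k n →
  (column j a (suc k) , 1ℚ) ∷ withWeight 1ℚ (columnTail j a (suc k) n) ⇛[ columnCost k n ] □s n
column-refutation j a k zero    = ⇛-discard (0≤1 ∷ []) ⇛-refl
column-refutation j a k (suc n) =
  ⇛-respˡ (≋-reflexive (cong (λ F → (column j a (suc k) , 1ℚ) ∷ (pos (a + suc k , j) ∷ [] , 1ℚ) ∷ F)
                               (Listₚ.map-++ _ (exclusions j a (suc k) (a + suc k)) (columnTail j a (suc (suc k)) n))))
    (⇛-trans (⇛-frame (withWeight-NonNeg 0≤1 _) (column-stage j a k))
             (⇛-++ (withWeight-NonNeg 0≤1 _) (0≤1 ∷ []) ⇛-refl (column-refutation j a (suc k) n)))

columnCost-≤ : ∀ k n {B} → suc (k + n) ≤ B → columnCost k n ≤ n * B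
columnCost-≤ k zero    _      = ℕ.z≤n
columnCost-≤ k (suc n) {B} k+n<B =
  ℕₚ.+-mono-≤ (ℕₚ.≤-trans (ℕ.s≤s (ℕ.s≤s (ℕₚ.m≤m+n k n))) sk+n<B) (columnCost-≤ (suc k) n sk+n<B)
  where
  sk+n<B : suc (suc k + n) ≤ B
  sk+n<B = subst (λ x → suc x ≤ B) (ℕₚ.+-suc k n) k+n<B

-- SPHP¹ as the union of its blocks

∑ℕ : ℕ → (ℕ → ℚ) → ℚ
∑ℕ n f = sum {n} (f ∘ toℕ)

∑ℕ-cong : ∀ n {f g : ℕ → ℚ} → (∀ x → f x ≡ g x) → ∑ℕ n f ≡ ∑ℕ n g
∑ℕ-cong n f≗g = sum-cong-≗ {n} (f≗g ∘ toℕ)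

∑ℕ-cong-< : ∀ n {f g : ℕ → ℚ} → (∀ x → x < n → f x ≡ g x) → ∑ℕ n f ≡ ∑ℕ n g
∑ℕ-cong-< n f≗g = sum-cong-≗ (λ i → f≗g (toℕ i) (toℕ<n i))

∑ℕ-distrib : ∀ n (f g : ℕ → ℚ) → ∑ℕ n (λ x → f x ℚ.+ g x) ≡ ∑ℕ n f ℚ.+ ∑ℕ n g
∑ℕ-distrib n f g = ∑-distrib-+ {n} (f ∘ toℕ) (g ∘ toℕ)

∑ℕ-comm : ∀ n p (f : ℕ → ℕ → ℚ) → ∑ℕ n (λ x → ∑ℕ p (f x)) ≡ ∑ℕ p (λ y → ∑ℕ n (λ x → f x y))
∑ℕ-comm n p f = ∑-comm {n} {p} (λ x y → f (toℕ x) (toℕ y))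

∑ℕ-suc-offset : ∀ n a (f : ℕ → ℚ) → ∑ℕ (suc n) (λ y → f (a + y)) ≡ f a ℚ.+ ∑ℕ n (λ y → f (suc a + y))
∑ℕ-suc-offset n a f = cong₂ ℚ._+_ (cong f (ℕₚ.+-identityʳ a)) (∑ℕ-cong n (λ y → cong f (ℕₚ.+-suc a y)))

∑ℕ-truncate : ∀ N t (g : ℕ → ℚ) → t ≤ N → ∑ℕ N (λ i → if i <ᵇ t then g i else 0ℚ) ≡ ∑ℕ t g
∑ℕ-truncate N       zero    g _         = sum-replicate-zero N
∑ℕ-truncate (suc N) (suc t) g (ℕ.s≤s t≤N) = cong (g 0 ℚ.+_) (∑ℕ-truncate N t (g ∘ suc) t≤N)

∑ℕ-lowerTriangle : ∀ m (p : ℕ → ℚ) (a : ℕ → ℕ → ℚ) →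
  ∑ℕ (suc m) p ℚ.+ ∑ℕ (suc m) (λ i′ → ∑ℕ (suc m) (λ i → if i <ᵇ i′ then a i i′ else 0ℚ))
  ≡ p 0 ℚ.+ ∑ℕ m (λ x → p (suc x) ℚ.+ ∑ℕ (suc x) (λ y → a y (suc x)))
∑ℕ-lowerTriangle m p a = begin
  (p 0 ℚ.+ ∑p) ℚ.+ (∑ℕ (suc m) (λ i → if i <ᵇ 0 then a i 0 else 0ℚ) ℚ.+ ∑a)
    ≡⟨ cong (λ z → (p 0 ℚ.+ ∑p) ℚ.+ (z ℚ.+ ∑a)) (∑ℕ-truncate (suc m) 0 (λ i → a i 0) ℕ.z≤n) ⟩
  (p 0 ℚ.+ ∑p) ℚ.+ (0ℚ ℚ.+ ∑a)
    ≡⟨ cong ((p 0 ℚ.+ ∑p) ℚ.+_) (trans (ℚₚ.+-identityˡ ∑a) (∑ℕ-cong-< m (λ x x<m →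
         ∑ℕ-truncate (suc m) (suc x) (λ i → a i (suc x)) (ℕₚ.m≤n⇒m≤1+n x<m)))) ⟩
  (p 0 ℚ.+ ∑p) ℚ.+ ∑a′
    ≡⟨ ℚₚ.+-assoc (p 0) ∑p ∑a′ ⟩
  p 0 ℚ.+ (∑p ℚ.+ ∑a′)
    ≡⟨ cong (p 0 ℚ.+_) (∑ℕ-distrib m (p ∘ suc) (λ x → ∑ℕ (suc x) (λ y → a y (suc x)))) ⟨
  p 0 ℚ.+ ∑ℕ m (λ x → p (suc x) ℚ.+ ∑ℕ (suc x) (λ y → a y (suc x))) ∎
  where
  open ≡-Reasoning
  ∑p = ∑ℕ m (p ∘ suc)
  ∑a = ∑ℕ m (λ x → ∑ℕ (suc m) (λ i → if i <ᵇ suc x then a i (suc x) else 0ℚ))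
  ∑a′ = ∑ℕ m (λ x → ∑ℕ (suc x) (λ y → a y (suc x)))

weight-concatMap-applyUpTo : ∀ (g : ℕ → Formula) f n C →
  weight (concatMap g (applyUpTo f n)) C ≡ ∑ℕ n (λ i → weight (g (f i)) C)
weight-concatMap-applyUpTo g f zero    C = refl
weight-concatMap-applyUpTo g f (suc n) C =
  trans (weight-++ (g (f 0)) _ C) (cong (weight (g (f 0)) C ℚ.+_) (weight-concatMap-applyUpTo g (f ∘ suc) n C))

weight-concatMap-range : ∀ (g : ℕ → Formula) n C →
  weight (concatMap g (range n)) C ≡ ∑ℕ n (λ i → weight (g (suc i)) C)
weight-concatMap-range g n C =
  trans (cong (λ F → weight (concatMap g F) C) (Listₚ.map-upTo suc n)) (weight-concatMap-applyUpTo g suc n C)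

weight-withWeight-++ : ∀ u Cs Ds C →
  weight (withWeight u (Cs ++ Ds)) C ≡ weight (withWeight u Cs) C ℚ.+ weight (withWeight u Ds) C
weight-withWeight-++ u Cs Ds C =
  trans (cong (λ F → weight F C) (Listₚ.map-++ _ Cs Ds)) (weight-++ (withWeight u Cs) (withWeight u Ds) C)

weight-withWeight-concatMap-range : ∀ u (g : ℕ → List Clause) n C →
  weight (withWeight u (concatMap g (range n))) C ≡ ∑ℕ n (λ i → weight (withWeight u (g (suc i))) C)
weight-withWeight-concatMap-range u g n C =
  trans (cong (λ F → weight F C) (Listₚ.map-concatMap _ g (range n))) (weight-concatMap-range (withWeight u ∘ g) n C)

weight-withWeight-map-range : ∀ u (g : ℕ → Clause) n C →
  weight (withWeight u (map g (range n))) C ≡ ∑ℕ n (λ i → weight [ (g (suc i) , u) ] C)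
weight-withWeight-map-range u g n C = begin
  weight (withWeight u (map g (range n))) C
    ≡⟨ cong (λ F → weight (withWeight u F) C) (Listₚ.concatMap-pure (map g (range n))) ⟨
  weight (withWeight u (concatMap [_] (map g (range n)))) C
    ≡⟨ cong (λ F → weight (withWeight u F) C) (Listₚ.concatMap-map [_] g (range n)) ⟩
  weight (withWeight u (concatMap ([_] ∘ g) (range n))) C
    ≡⟨ weight-withWeight-concatMap-range u ([_] ∘ g) n C ⟩
  ∑ℕ n (λ i → weight [ (g (suc i) , u) ] C) ∎
  where open ≡-Reasoning

δ : Clause → Clause → ℚ
δ D C = weight [ (D , 1ℚ) ] C

weight-∷ : ∀ D F C → weight ((D , 1ℚ) ∷ F) C ≡ δ D C ℚ.+ weight F C
weight-∷ D F C = weight-++ [ (D , 1ℚ) ] F C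

weight-exclusions : ∀ j a n t C →
  weight (withWeight 1ℚ (exclusions j a n t)) C ≡ ∑ℕ n (λ y → δ (neg (a + y , j) ∷ neg (t , j) ∷ []) C)
weight-exclusions j a zero    t C = refl
weight-exclusions j a (suc n) t C = begin
  weight (withWeight 1ℚ (exclusions j a (suc n) t)) C
    ≡⟨ weight-∷ (neg (a , j) ∷ neg (t , j) ∷ []) (withWeight 1ℚ (exclusions j (suc a) n t)) C ⟩
  exclusion a ℚ.+ weight (withWeight 1ℚ (exclusions j (suc a) n t)) C
    ≡⟨ cong (exclusion a ℚ.+_) (weight-exclusions j (suc a) n t C) ⟩
  exclusion a ℚ.+ ∑ℕ n (λ y → exclusion (suc a + y))
    ≡⟨ ∑ℕ-suc-offset n a exclusion ⟨
  ∑ℕ (suc n) (λ y → exclusion (a + y)) ∎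
  where
  open ≡-Reasoning
  exclusion : ℕ → ℚ
  exclusion i = δ (neg (i , j) ∷ neg (t , j) ∷ []) C

stageWeight : ℕ → ℕ → Clause → ℕ → ℚ
stageWeight j a C k =
  δ (pos (a + k , j) ∷ []) C ℚ.+ ∑ℕ k (λ y → δ (neg (a + y , j) ∷ neg (a + k , j) ∷ []) C)

weight-columnTail : ∀ j a k n C →
  weight (withWeight 1ℚ (columnTail j a k n)) C ≡ ∑ℕ n (λ x → stageWeight j a C (k + x))
weight-columnTail j a k zero    C = refl
weight-columnTail j a k (suc n) C = begin
  weight (withWeight 1ℚ (columnTail j a k (suc n))) C
    ≡⟨ weight-∷ (pos (a + k , j) ∷ []) (withWeight 1ℚ (exclusions j a k (a + k) ++ columnTail j a (suc k) n)) C ⟩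
  δ (pos (a + k , j) ∷ []) C ℚ.+ weight (withWeight 1ℚ (exclusions j a k (a + k) ++ columnTail j a (suc k) n)) C
    ≡⟨ cong (δ (pos (a + k , j) ∷ []) C ℚ.+_) (weight-withWeight-++ 1ℚ (exclusions j a k (a + k)) _ C) ⟩
  δ (pos (a + k , j) ∷ []) C ℚ.+ (weight (withWeight 1ℚ (exclusions j a k (a + k))) C
                                    ℚ.+ weight (withWeight 1ℚ (columnTail j a (suc k) n)) C)
    ≡⟨ cong₂ (λ u v → δ (pos (a + k , j) ∷ []) C ℚ.+ (u ℚ.+ v))
             (weight-exclusions j a k (a + k) C) (weight-columnTail j a (suc k) n C) ⟩
  δ (pos (a + k , j) ∷ []) C ℚ.+ (∑ℕ k (λ y → δ (neg (a + y , j) ∷ neg (a + k , j) ∷ []) C)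
                                    ℚ.+ ∑ℕ n (λ x → stageWeight j a C (suc k + x)))
    ≡⟨ ℚₚ.+-assoc (δ (pos (a + k , j) ∷ []) C) _ _ ⟨
  stageWeight j a C k ℚ.+ ∑ℕ n (λ x → stageWeight j a C (suc k + x))
    ≡⟨ ∑ℕ-suc-offset n k (stageWeight j a C) ⟨
  ∑ℕ (suc n) (λ x → stageWeight j a C (k + x)) ∎
  where open ≡-Reasoning

rowBlock : ℕ → ℕ → Formula
rowBlock m i = (row i (range m) , 1ℚ) ∷ rowNegations i (range m)

columnBlock : ℕ → ℕ → Formula
columnBlock m j = (column j 1 1 , 1ℚ) ∷ withWeight 1ℚ (columnTail j 1 1 m)

weight-if : ∀ b D C → weight (withWeight 1ℚ (if b then [ D ] else [])) C ≡ (if b then δ D C else 0ℚ)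
weight-if true  D C = refl
weight-if false D C = refl

module Accounting (m : ℕ) (C : Clause) where

  -- Indices are shifted: rowTerm i, posTerm i j, … concern pigeon i + 1 and hole j + 1.
  rowTerm : ℕ → ℚ
  rowTerm i = δ (row (suc i) (range m)) C

  posTerm negTerm : ℕ → ℕ → ℚ
  posTerm i j = δ (pos (suc i , suc j) ∷ []) C
  negTerm i j = δ (neg (suc i , suc j) ∷ []) C

  exclusionTerm : ℕ → ℕ → ℕ → ℚ
  exclusionTerm i i′ j = δ (neg (suc i , suc j) ∷ neg (suc i′ , suc j) ∷ []) C

  triangle : ℕ → ℕ → ℕ → ℚ
  triangle j i i′ = if i <ᵇ i′ then exclusionTerm i i′ j else 0ℚ

  ∑rows ∑exclusions ∑units : ℚ
  ∑rows = ∑ℕ (suc m) rowTerm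
  ∑exclusions = ∑ℕ m (λ j → ∑ℕ (suc m) (λ i → ∑ℕ (suc m) (triangle j i)))
  ∑units = ∑ℕ (suc m) (λ i → ∑ℕ m (λ j → posTerm i j ℚ.+ negTerm i j))

  weight-SPHP¹ : weight (SPHP¹ m) C ≡ (∑rows ℚ.+ ∑exclusions) ℚ.+ ∑units
  weight-SPHP¹ = begin
    weight (SPHP¹ m) C
      ≡⟨ weight-++ (withWeight 1ℚ (K m)) units C ⟩
    weight (withWeight 1ℚ (K m)) C ℚ.+ weight units C
      ≡⟨ cong (ℚ._+ weight units C) (weight-withWeight-++ 1ℚ rows atMostOne C) ⟩
    (weight (withWeight 1ℚ rows) C ℚ.+ weight (withWeight 1ℚ atMostOne) C) ℚ.+ weight units C
      ≡⟨ cong₂ (λ u v → (u ℚ.+ v) ℚ.+ weight units C)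
               (weight-withWeight-map-range 1ℚ (λ i → row i (range m)) (suc m) C) weight-atMostOne ⟩
    (∑rows ℚ.+ ∑exclusions) ℚ.+ weight units C
      ≡⟨ cong ((∑rows ℚ.+ ∑exclusions) ℚ.+_) weight-units ⟩
    (∑rows ℚ.+ ∑exclusions) ℚ.+ ∑units ∎
    where
    open ≡-Reasoning
    rows = map (λ i → row i (range m)) (range (suc m))
    exclusionIf : ℕ → ℕ → ℕ → List Clause
    exclusionIf j i i′ = if i <ᵇ i′ then [ neg (i , j) ∷ neg (i′ , j) ∷ [] ] else []
    hole : ℕ → List Clause
    hole j = concatMap (λ i → concatMap (exclusionIf j i) (range (suc m))) (range (suc m))
    atMostOne = concatMap hole (range m)
    unitPair : ℕ → ℕ → Formula
    unitPair i j = (pos (i , j) ∷ [] , 1ℚ) ∷ (neg (i , j) ∷ [] , 1ℚ) ∷ []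
    units = concatMap (λ i → concatMap (unitPair i) (range m)) (range (suc m))
    weight-atMostOne : weight (withWeight 1ℚ atMostOne) C ≡ ∑exclusions
    weight-atMostOne =
      trans (weight-withWeight-concatMap-range 1ℚ hole m C) (∑ℕ-cong m λ j →
      trans (weight-withWeight-concatMap-range 1ℚ (λ i → concatMap (exclusionIf (suc j) i) (range (suc m))) (suc m) C)
            (∑ℕ-cong (suc m) λ i →
      trans (weight-withWeight-concatMap-range 1ℚ (exclusionIf (suc j) (suc i)) (suc m) C)
            (∑ℕ-cong (suc m) λ i′ →
      weight-if (i <ᵇ i′) (neg (suc i , suc j) ∷ neg (suc i′ , suc j) ∷ []) C)))
    weight-units : weight units C ≡ ∑units
    weight-units =
      trans (weight-concatMap-range (λ i → concatMap (unitPair i) (range m)) (suc m) C) (∑ℕ-cong (suc m) λ i →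
      trans (weight-concatMap-range (unitPair (suc i)) m C) (∑ℕ-cong m λ j →
      weight-∷ (pos (suc i , suc j) ∷ []) [ (neg (suc i , suc j) ∷ [] , 1ℚ) ] C))

  ∑rowBlocks ∑columnBlocks : ℚ
  ∑rowBlocks = ∑ℕ (suc m) (λ i → rowTerm i ℚ.+ ∑ℕ m (negTerm i))
  ∑columnBlocks =
    ∑ℕ m (λ j → posTerm 0 j ℚ.+ ∑ℕ m (λ x → posTerm (suc x) j ℚ.+ ∑ℕ (suc x) (λ y → exclusionTerm y (suc x) j)))

  weight-rowBlocks : weight (concatMap (rowBlock m) (range (suc m))) C ≡ ∑rowBlocks
  weight-rowBlocks =
    trans (weight-concatMap-range (rowBlock m) (suc m) C) (∑ℕ-cong (suc m) λ i →
    trans (weight-∷ (row (suc i) (range m)) (rowNegations (suc i) (range m)) C)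
          (cong (rowTerm i ℚ.+_) (weight-withWeight-map-range 1ℚ (λ j → neg (suc i , j) ∷ []) m C)))

  weight-columnBlocks : weight (concatMap (columnBlock m) (range m)) C ≡ ∑columnBlocks
  weight-columnBlocks =
    trans (weight-concatMap-range (columnBlock m) m C) (∑ℕ-cong m λ j →
    trans (weight-∷ (column (suc j) 1 1) (withWeight 1ℚ (columnTail (suc j) 1 1 m)) C)
          (cong (posTerm 0 j ℚ.+_) (weight-columnTail (suc j) 1 1 m C)))

  blocks-balance : (∑rows ℚ.+ ∑exclusions) ℚ.+ ∑units ≡ ∑rowBlocks ℚ.+ ∑columnBlocks
  blocks-balance = begin
    (∑rows ℚ.+ ∑exclusions) ℚ.+ ∑units
      ≡⟨ cong₂ (λ u v → (∑rows ℚ.+ u) ℚ.+ v) (∑ℕ-cong m (λ j → ∑ℕ-comm (suc m) (suc m) (triangle j))) split-units ⟩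
    (∑rows ℚ.+ ∑ℕ m lower) ℚ.+ (∑ℕ m posColumn ℚ.+ ∑neg)
      ≡⟨ +-*-Solver.solve 4 (λ a b c d → (a :+ b) :+ (c :+ d) := (a :+ d) :+ (c :+ b)) refl
                            ∑rows (∑ℕ m lower) (∑ℕ m posColumn) ∑neg ⟩
    (∑rows ℚ.+ ∑neg) ℚ.+ (∑ℕ m posColumn ℚ.+ ∑ℕ m lower)
      ≡⟨ cong₂ ℚ._+_ (∑ℕ-distrib (suc m) rowTerm (λ i → ∑ℕ m (negTerm i))) (∑ℕ-distrib m posColumn lower) ⟨
    ∑rowBlocks ℚ.+ ∑ℕ m (λ j → posColumn j ℚ.+ lower j)
      ≡⟨ cong (∑rowBlocks ℚ.+_) (∑ℕ-cong m λ j →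
           ∑ℕ-lowerTriangle m (λ i → posTerm i j) (λ i i′ → exclusionTerm i i′ j)) ⟩
    ∑rowBlocks ℚ.+ ∑columnBlocks ∎
    where
    open ≡-Reasoning
    open +-*-Solver using (_:+_; _:=_)
    posColumn lower : ℕ → ℚ
    posColumn j = ∑ℕ (suc m) (λ i → posTerm i j)
    lower j = ∑ℕ (suc m) (λ i′ → ∑ℕ (suc m) (λ i → triangle j i i′))
    ∑neg = ∑ℕ (suc m) (λ i → ∑ℕ m (negTerm i))
    split-units : ∑units ≡ ∑ℕ m posColumn ℚ.+ ∑neg
    split-units = begin
      ∑units
        ≡⟨ ∑ℕ-cong (suc m) (λ i → ∑ℕ-distrib m (posTerm i) (negTerm i)) ⟩
      ∑ℕ (suc m) (λ i → ∑ℕ m (posTerm i) ℚ.+ ∑ℕ m (negTerm i))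
        ≡⟨ ∑ℕ-distrib (suc m) (λ i → ∑ℕ m (posTerm i)) (λ i → ∑ℕ m (negTerm i)) ⟩
      ∑ℕ (suc m) (λ i → ∑ℕ m (posTerm i)) ℚ.+ ∑neg
        ≡⟨ cong (ℚ._+ ∑neg) (∑ℕ-comm (suc m) m posTerm) ⟩
      ∑ℕ m posColumn ℚ.+ ∑neg ∎

SPHP¹-blocks : ∀ m → SPHP¹ m ≋ concatMap (rowBlock m) (range (suc m)) ++ concatMap (columnBlock m) (range m)
SPHP¹-blocks m = mk≋ λ C → let open Accounting m C in begin
  weight (SPHP¹ m) C                                  ≡⟨ weight-SPHP¹ ⟩
  (∑rows ℚ.+ ∑exclusions) ℚ.+ ∑units                  ≡⟨ blocks-balance ⟩
  ∑rowBlocks ℚ.+ ∑columnBlocks                        ≡⟨ cong₂ ℚ._+_ weight-rowBlocks weight-columnBlocks ⟨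
  weight (concatMap (rowBlock m) (range (suc m))) C ℚ.+ weight (concatMap (columnBlock m) (range m)) C
                                                      ≡⟨ weight-++ (concatMap (rowBlock m) (range (suc m))) _ C ⟨
  weight (concatMap (rowBlock m) (range (suc m)) ++ concatMap (columnBlock m) (range m)) C ∎
  where open ≡-Reasoning

SPHP¹-refutation : ∀ m → SPHP¹ m ⇛[ suc m * m + m * columnCost 0 m ] □s (m * m + m + 1)
SPHP¹-refutation m =
  ⇛-respˡ (SPHP¹-blocks m)
    (⇛-respʳ (≋-reflexive (trans (□s-++ (suc m * 1) (m * m)) (cong □s (count m))))
      (⇛-++ (NonNeg-concatMap _ (range m) (λ _ → 0≤1 ∷ withWeight-NonNeg 0≤1 _)) (□s-NonNeg (suc m * 1))
        (⇛-concatMap-range-□s (suc m) (λ _ → 0≤1 ∷ withWeight-NonNeg 0≤1 _)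
          (λ i → ⇛-cost (length-range m) (row-refutation i (range m))))
        (⇛-concatMap-range-□s m (λ _ → 0≤1 ∷ withWeight-NonNeg 0≤1 _) (λ j → column-refutation j 1 0 m))))
  where
  count : ∀ m → suc m * 1 + m * m ≡ m * m + m + 1
  count = solve-∀

refutationLength-≤ : ∀ m → 1 ≤ m → suc m * m + m * columnCost 0 m ≤ 4 * m ^ 3 + 4
refutationLength-≤ m 1≤m = begin
  suc m * m + m * columnCost 0 m       ≤⟨ ℕₚ.+-monoʳ-≤ (suc m * m) (ℕₚ.*-monoʳ-≤ m (columnCost-≤ 0 m ℕₚ.≤-refl)) ⟩
  suc m * m + m * (m * suc m)          ≡⟨ expand m ⟩
  m * (suc m * suc m)                  ≤⟨ ℕₚ.*-monoʳ-≤ m (ℕₚ.*-mono-≤ m<m+m m<m+m) ⟩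
  m * ((m + m) * (m + m))              ≡⟨ cube m ⟩
  4 * m ^ 3                            ≤⟨ ℕₚ.m≤m+n (4 * m ^ 3) 4 ⟩
  4 * m ^ 3 + 4                        ∎
  where
  open ℕₚ.≤-Reasoning
  m<m+m : suc m ≤ m + m
  m<m+m = ℕₚ.+-monoˡ-≤ m 1≤m
  expand : ∀ m → suc m * m + m * (m * suc m) ≡ m * (suc m * suc m)
  expand = solve-∀
  cube : ∀ m → m * ((m + m) * (m + m)) ≡ 4 * (m * (m * (m * 1)))
  cube = solve-∀

mainTheorem15 : ∃₂ λ (c k : ℕ) → ∀ (m : ℕ) → 1 ≤ m →
    ∃ λ (e : ℕ) → e ≤ c * m ^ k + c ×
    SPHP¹ m ⊢Res[ e ] ((□ , fromℕ (m * m + m + 1)) ∷ [])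
mainTheorem15 = 4 , 3 , λ m 1≤m →
  suc m * m + m * columnCost 0 m , refutationLength-≤ m 1≤m ,
  ⇛⇒⊢Res (SPHP¹-refutation m) (ℚₚ.≤-reflexive (sym (weight-□s (m * m + m + 1))))
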